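{- Let $r$ be a positive integer, $R=\lfloor r/2\rfloor$, let $n\ge 2R^2+2R+1$ be an integer and let $D=\{a_1,\ldots,a_\mu\}$ be a $B_2$-sequence over $\mathbb{Z}_n$. Let $f(i,j)\equiv iR+j(R+1)\pmod n$, and define the array $\mathcal{A}$ on $\mathbb{Z}^2$ by placing a dot at $(i,j)$ if and only if $f(i,j)\in D$. Then $\mathcal{A}$ is doubly periodic with period $(n,n)$ and density $\mu/n$, and the dots contained in any Lee sphere of radius $R$ form a DDC.
   Context: For an abelian group $A$, a sequence of $\mu$ distinct elements $a_1,\ldots,a_\mu$ of $A$ is a $B_2$-sequence over $A$ if all sums $a_{i_1}+a_{i_2}$ with $1\le i_1\le i_2\le\mu$ are distinct. Points $(i,j)\in\mathbb{Z}^2$ are in column $i$ and row $j$. An array of dots on $\mathbb{Z}^2$ is doubly periodic with period $(\eta,\kappa)$ if $(i,j)$ is a dot iff $(i+\eta,j)$ is a dot iff $(i,j+\kappa)$ is a dot, for all $i,j$; its density is $d/(\eta\kappa)$, where $d$ is the number of dots in any set $\{(i_0+i,j_0+j):0\le i\le\eta-1,0\le j\le\kappa-1\}$. A Lee sphere of radius $R$ is the set of points of $\mathbb{Z}^2$ at Manhattan distance ($|\Delta i|+|\Delta j|$) at most $R$ from a centre point of $\mathbb{Z}^2$. A set of dots is a DDC if the vectors $x-y$, over ordered pairs $(x,y)$ of distinct dots, are pairwise distinct. -}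

module Defs where

open import Data.Nat as ℕ using (ℕ; zero; suc)
open import Data.Integer as ℤ using (ℤ; +_; _-_)
open import Data.Integer.DivMod using (_%ℕ_)
open import Data.Fin using (Fin; toℕ)
open import Data.Product using (Σ; _×_; _,_; ∃)
open import Data.Bool using (Bool; true; false)
open import Relation.Nullary using (Dec; yes; no; ¬_)
open import Relation.Binary.PropositionalEquality using (_≡_; _≢_)
open import Function.Bundles using (_⇔_)
open import Data.Fin.Properties using (any?)
open import Data.Nat.Properties using (_≟_)

-- Points of ℤ²: (column , row)
Point : Set
Point = ℤ × ℤ

_-ᵖ_ : Point → Point → Point
(i , j) -ᵖ (i' , j') = (i - i') , (j - j')

IsB₂Sequence : (n : ℕ) .{{_ : ℕ.NonZero n}} → (μ : ℕ) → (Fin μ → Fin n) → Set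
IsB₂Sequence n μ a =
  (∀ k l → a k ≡ a l → k ≡ l) ×
  (∀ i₁ i₂ j₁ j₂ → toℕ i₁ ℕ.≤ toℕ i₂ → toℕ j₁ ℕ.≤ toℕ j₂ →
     (toℕ (a i₁) ℕ.+ toℕ (a i₂)) ℕ.% n ≡ (toℕ (a j₁) ℕ.+ toℕ (a j₂)) ℕ.% n →
     (i₁ ≡ j₁) × (i₂ ≡ j₂))

Array : Set₁
Array = ℤ → ℤ → Set

DoublyPeriodic : Array → ℕ → ℕ → Set
DoublyPeriodic A η κ =
  ∀ i j → (A i j ⇔ A (i ℤ.+ + η) j) × (A i j ⇔ A i (j ℤ.+ + κ))

private
  count : (ℕ → Bool) → ℕ → ℕ
  count p zero = zero
  count p (suc m) with p m
  ... | true  = suc (count p m)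
  ... | false = count p m

  isYes : {P : Set} → Dec P → Bool
  isYes (yes _) = true
  isYes (no _)  = false

windowCount : (A : Array) → (∀ i j → Dec (A i j)) → ℤ → ℤ → ℕ → ℕ → ℕ
windowCount A A? i₀ j₀ zero κ = zero
windowCount A A? i₀ j₀ (suc η) κ =
  count (λ j → isYes (A? (i₀ ℤ.+ + η) (j₀ ℤ.+ + j))) κ ℕ.+ windowCount A A? i₀ j₀ η κ

-- density of a doubly periodic array with period (η, κ) is d/(ηκ), d the dot count of any
-- η×κ window; "density equals p/q" is stated as: every window has d with d * q ≡ p * (η * κ).
HasDensity : (A : Array) → (∀ i j → Dec (A i j)) → ℕ → ℕ → ℕ → ℕ → Set
HasDensity A A? η κ p q =
  ∀ i₀ j₀ → windowCount A A? i₀ j₀ η κ ℕ.* q ≡ p ℕ.* (η ℕ.* κ)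

InLeeSphere : ℕ → Point → Point → Set
InLeeSphere R (ci , cj) (i , j) = ℤ.∣ i - ci ∣ ℕ.+ ℤ.∣ j - cj ∣ ℕ.≤ R

IsDDC : (Point → Set) → Set
IsDDC S = ∀ x y x' y' → S x → S y → S x' → S y' → x ≢ y → x' ≢ y' →
  x -ᵖ y ≡ x' -ᵖ y' → (x ≡ x') × (y ≡ y')

f : (n : ℕ) .{{_ : ℕ.NonZero n}} → ℕ → ℤ → ℤ → ℕ
f n R i j = (i ℤ.* + R ℤ.+ j ℤ.* + (suc R)) %ℕ n

arrayA : (n : ℕ) .{{_ : ℕ.NonZero n}} → (μ : ℕ) → (Fin μ → Fin n) → ℕ → Array
arrayA n μ a R i j = ∃ λ k → toℕ (a k) ≡ f n R i j

arrayA? : (n : ℕ) .{{_ : ℕ.NonZero n}} → (μ : ℕ) → (a : Fin μ → Fin n) → (R : ℕ) →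
  ∀ i j → Dec (arrayA n μ a R i j)
arrayA? n μ a R i j = any? (λ k → toℕ (a k) ≟ f n R i j)

-- The map φ(i, j) = iR + j(R+1) sends a Lee sphere of radius R injectively into ℤ_n: a nonzero
-- difference (u, v) with |u| + |v| ≤ 2R has 0 < |uR + v(R+1)| ≤ 2R(R+1) < n, since
-- uR + v(R+1) = 0 forces (u, v) to be a multiple of (R+1, -R). Hence a coincidence of
-- differences x − y = x' − y' of dots in a sphere gives a coincidence of sums
-- φ x + φ y' ≡ φ x' + φ y of elements of D, which the B₂ property resolves. Periodicity is
-- immediate, and the density follows by counting an n × n window column by column after the
-- shear (i, j) ↦ (i + j, j), which turns φ into iR + j.
module Submission where

open import Defs
open import Data.Nat using (ℕ; _≤_; _+_; _*_; _/_; NonZero)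
open import Data.Fin using (Fin)
open import Data.Product using (_×_; proj₁; proj₂)

open import Data.Empty using (⊥-elim)
open import Data.Fin as Fin using (toℕ)
open import Data.Fin.Properties using (any?; toℕ<n; toℕ-injective; suc-injective)
open import Data.Integer as ℤ using (ℤ; +_; -[1+_]; _-_; ∣_∣; 0ℤ)
open import Data.Integer.DivMod using (_%ℕ_; _/ℕ_; a≡a%ℕn+[a/ℕn]*n; n%ℕd<d)
open import Data.Integer.Divisibility.Signed using (_∣_; divides; ∣⇒∣ᵤ; ∣m∣n⇒∣m+n; ∣m⇒∣-m)
import Data.Integer.Properties as ℤ
open import Data.Integer.Tactic.RingSolver using (solve-∀)
open import Data.Nat using (zero; suc; _<_; _%_; _≟_; _⊔_)
open import Data.Nat.DivMod using (m<n⇒m%n≡m)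
open import Data.Nat.Divisibility using (n∣m⇒m%n≡0)
import Data.Nat.Properties as ℕ
open import Algebra.Properties.CommutativeSemigroup ℕ.+-commutativeSemigroup using (interchange; x∙yz≈y∙xz)
open import Data.Nat.Tactic.RingSolver using () renaming (solve-∀ to ℕ-solve-∀)
open import Data.Product using (_,_; ∃)
import Data.Product as Product
open import Data.Sum using (_⊎_; inj₁; inj₂)
open import Function using (_∘_)
open import Function.Bundles using (_⇔_; mk⇔)
open import Function.Definitions using (Injective)
open import Relation.Binary.PropositionalEquality
open import Relation.Nullary using (Dec; yes; no; ¬_)

-- Congruence modulo n on ℤ

infix 4 _≡_[mod_]

-- Opaque so that x and y can be inferred: unfolded, they only occur under the non-injective x - y.
opaque
  _≡_[mod_] : ℤ → ℤ → ℕ → Set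
  x ≡ y [mod n ] = + n ∣ x - y

opaque
  unfolding _≡_[mod_]

  ≡-mod-sym : ∀ {n x y} → x ≡ y [mod n ] → y ≡ x [mod n ]
  ≡-mod-sym {n} {x} {y} n∣x-y = subst (+ n ∣_) (-[x-y]≡y-x x y) (∣m⇒∣-m n∣x-y)
    where
    -[x-y]≡y-x : ∀ x y → ℤ.- (x - y) ≡ y - x
    -[x-y]≡y-x = solve-∀

  ≡-mod-trans : ∀ {n x y z} → x ≡ y [mod n ] → y ≡ z [mod n ] → x ≡ z [mod n ]
  ≡-mod-trans {n} {x} {y} {z} n∣x-y n∣y-z = subst (+ n ∣_) (telescope x y z) (∣m∣n⇒∣m+n n∣x-y n∣y-z)
    where
    telescope : ∀ x y z → (x - y) ℤ.+ (y - z) ≡ x - z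
    telescope = solve-∀

  ≡-mod-+ : ∀ {n x y x' y'} → x ≡ x' [mod n ] → y ≡ y' [mod n ] → x ℤ.+ y ≡ x' ℤ.+ y' [mod n ]
  ≡-mod-+ {n} {x} {y} {x'} {y'} n∣x-x' n∣y-y' =
    subst (+ n ∣_) (regroup x y x' y') (∣m∣n⇒∣m+n n∣x-x' n∣y-y')
    where
    regroup : ∀ x y x' y' → (x - x') ℤ.+ (y - y') ≡ (x ℤ.+ y) - (x' ℤ.+ y')
    regroup = solve-∀

  +-multiple⇒≡-mod : ∀ {n x} y k → x ≡ y ℤ.+ k ℤ.* + n → x ≡ y [mod n ]
  +-multiple⇒≡-mod {n} y k x≡y+kn = divides k (trans (cong (_- y) x≡y+kn) (cancel y k (+ n)))
    where
    cancel : ∀ y k n → (y ℤ.+ k ℤ.* n) - y ≡ k ℤ.* n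
    cancel = solve-∀

  ≡-mod∧∣-∣<⇒≡ : ∀ {n x y} .{{_ : NonZero n}} → x ≡ y [mod n ] → ∣ x - y ∣ < n → x ≡ y
  ≡-mod∧∣-∣<⇒≡ {n} {x} {y} n∣x-y ∣x-y∣<n = ℤ.i-j≡0⇒i≡j x y (ℤ.∣i∣≡0⇒i≡0 ∣x-y∣≡0)
    where
    ∣x-y∣≡0 : ∣ x - y ∣ ≡ 0
    ∣x-y∣≡0 = trans (sym (m<n⇒m%n≡m ∣x-y∣<n)) (n∣m⇒m%n≡0 _ n (∣⇒∣ᵤ n∣x-y))

module _ {n : ℕ} .{{_ : NonZero n}} where

  %ℕ-≡-mod : ∀ x → + (x %ℕ n) ≡ x [mod n ]
  %ℕ-≡-mod x = ≡-mod-sym (+-multiple⇒≡-mod (+ (x %ℕ n)) (x /ℕ n) (a≡a%ℕn+[a/ℕn]*n x n))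

  %ℕ-≡⇒≡-mod : ∀ {x y} → x %ℕ n ≡ y %ℕ n → x ≡ y [mod n ]
  %ℕ-≡⇒≡-mod {x} {y} x%n≡y%n =
    ≡-mod-trans (≡-mod-sym (%ℕ-≡-mod x)) (subst (λ r → + r ≡ y [mod n ]) (sym x%n≡y%n) (%ℕ-≡-mod y))

  ≡-mod⇒%ℕ-≡ : ∀ {x y} → x ≡ y [mod n ] → x %ℕ n ≡ y %ℕ n
  ≡-mod⇒%ℕ-≡ {x} {y} x≡y = ℤ.+-injective (≡-mod∧∣-∣<⇒≡ residues≡ (∣+a-+b∣<n (n%ℕd<d x n) (n%ℕd<d y n)))
    where
    residues≡ : + (x %ℕ n) ≡ + (y %ℕ n) [mod n ]
    residues≡ = ≡-mod-trans (%ℕ-≡-mod x) (≡-mod-trans x≡y (≡-mod-sym (%ℕ-≡-mod y)))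
    ∣+a-+b∣<n : ∀ {a b} → a < n → b < n → ∣ + a - + b ∣ < n
    ∣+a-+b∣<n {a} {b} a<n b<n = ℕ.≤-<-trans
      (subst (λ d → ∣ d ∣ ≤ a ⊔ b) (sym (ℤ.m-n≡m⊖n a b)) (ℤ.∣m⊝n∣≤m⊔n a b)) (ℕ.⊔-lub a<n b<n)

  residues-+-cong : ∀ {A B C D} X Y Z W → A ≡ X %ℕ n → B ≡ Y %ℕ n → C ≡ Z %ℕ n → D ≡ W %ℕ n →
    X ℤ.+ Y ≡ Z ℤ.+ W → (A + B) % n ≡ (C + D) % n
  residues-+-cong {A} {B} {C} {D} X Y Z W A≡ B≡ C≡ D≡ X+Y≡Z+W = ≡-mod⇒%ℕ-≡
    (≡-mod-trans (≡-mod-+ (lift X A≡) (lift Y B≡))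
                 (subst (_≡ + C ℤ.+ + D [mod n ]) (sym X+Y≡Z+W) (≡-mod-sym (≡-mod-+ (lift Z C≡) (lift W D≡)))))
    where
    lift : ∀ {R} V → R ≡ V %ℕ n → + R ≡ V [mod n ]
    lift V R≡ = subst (λ r → + r ≡ V [mod n ]) (sym R≡) (%ℕ-≡-mod V)

-- Sums over initial segments of ℕ

∑ : ℕ → (ℕ → ℕ) → ℕ
∑ zero    g = 0
∑ (suc n) g = g n + ∑ n g

syntax ∑ n (λ j → e) = ∑[ j < n ] e

∑-cong : ∀ {g h} n → (∀ j → j < n → g j ≡ h j) → ∑ n g ≡ ∑ n h
∑-cong zero    g≡h = refl
∑-cong (suc n) g≡h = cong₂ _+_ (g≡h n ℕ.≤-refl) (∑-cong n (λ j j<n → g≡h j (ℕ.m<n⇒m<1+n j<n)))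

∑-const : ∀ n c → ∑[ j < n ] c ≡ n * c
∑-const zero    c = refl
∑-const (suc n) c = cong (_+_ c) (∑-const n c)

∑-distrib-+ : ∀ n g h → ∑[ j < n ] (g j + h j) ≡ ∑ n g + ∑ n h
∑-distrib-+ zero    g h = refl
∑-distrib-+ (suc n) g h = trans (cong (_+_ (g n + h n)) (∑-distrib-+ n g h)) (interchange (g n) (h n) _ _)

∑-comm : ∀ m n (F : ℕ → ℕ → ℕ) → ∑[ i < m ] ∑[ j < n ] F i j ≡ ∑[ j < n ] ∑[ i < m ] F i j
∑-comm zero    n F = sym (trans (∑-const n 0) (ℕ.*-zeroʳ n))
∑-comm (suc m) n F = trans (cong (_+_ (∑[ j < n ] F m j)) (∑-comm m n F)) (sym (∑-distrib-+ n (F m) _))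

∑-suc : ∀ n g → ∑ (suc n) g ≡ g 0 + ∑[ j < n ] g (suc j)
∑-suc zero    g = refl
∑-suc (suc n) g = trans (cong (_+_ (g (suc n))) (∑-suc n g)) (x∙yz≈y∙xz (g (suc n)) (g 0) _)

module _ {n} (G : ℤ → ℕ) (G-periodic : ∀ x → G (x ℤ.+ + n) ≡ G x) where

  private
    window : ℤ → ℕ
    window s = ∑[ j < n ] G (s ℤ.+ + j)

    window-suc : ∀ s → window (+ 1 ℤ.+ s) ≡ window s
    window-suc s = ℕ.+-cancelˡ-≡ (G s) _ _ (begin
      G s + window (+ 1 ℤ.+ s)                   ≡⟨ cong₂ _+_ (cong G (sym (ℤ.+-identityʳ s)))
                                                              (∑-cong n (λ j _ → cong G (shift s (+ j)))) ⟩
      G (s ℤ.+ + 0) + ∑[ j < n ] G (s ℤ.+ + suc j) ≡⟨ ∑-suc n (λ j → G (s ℤ.+ + j)) ⟨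
      G (s ℤ.+ + n) + window s                   ≡⟨ cong (_+ window s) (G-periodic s) ⟩
      G s + window s                             ∎)
      where
      open ≡-Reasoning
      shift : ∀ s j → (+ 1 ℤ.+ s) ℤ.+ j ≡ s ℤ.+ (+ 1 ℤ.+ j)
      shift = solve-∀

  ∑-periodic : ∀ s → ∑[ j < n ] G (s ℤ.+ + j) ≡ ∑[ j < n ] G (+ j)
  ∑-periodic (+ zero)       = refl
  ∑-periodic (+ suc k)      = trans (window-suc (+ k)) (∑-periodic (+ k))
  ∑-periodic -[1+ zero ]    = sym (window-suc -[1+ 0 ])
  ∑-periodic -[1+ suc k ]   = trans (sym (window-suc -[1+ suc k ])) (∑-periodic -[1+ k ])

𝟙 : ∀ {p} {P : Set p} → Dec P → ℕ
𝟙 (yes _) = 1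
𝟙 (no _)  = 0

-- The column count inside windowCount is private to Defs; it is reached by recursion on the
-- column length, with the remaining columns as a summand that cancels.
windowCount≡∑∑ : ∀ (A : Array) (A? : ∀ i j → Dec (A i j)) i₀ j₀ η κ →
  windowCount A A? i₀ j₀ η κ ≡ ∑[ i < η ] ∑[ j < κ ] 𝟙 (A? (i₀ ℤ.+ + i) (j₀ ℤ.+ + j))
windowCount≡∑∑ A A? i₀ j₀ zero    κ = refl
windowCount≡∑∑ A A? i₀ j₀ (suc η) κ = trans (last-column κ) (cong (_+_ _) (windowCount≡∑∑ A A? i₀ j₀ η κ))
  where
  column : ℕ → ℕ
  column κ = ∑[ j < κ ] 𝟙 (A? (i₀ ℤ.+ + η) (j₀ ℤ.+ + j))

  last-column : ∀ κ → windowCount A A? i₀ j₀ (suc η) κ ≡ column κ + windowCount A A? i₀ j₀ η κ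
  last-column zero    = refl
  last-column (suc κ) with A? (i₀ ℤ.+ + η) (j₀ ℤ.+ + κ) | last-column κ
  ... | yes _ | eq = cong (λ c → suc c + windowCount A A? i₀ j₀ η (suc κ)) (ℕ.+-cancelʳ-≡ _ _ _ eq)
  ... | no _  | eq = cong (λ c → c + windowCount A A? i₀ j₀ η (suc κ)) (ℕ.+-cancelʳ-≡ _ _ _ eq)

𝟙-any?-suc : ∀ {m p} {P : Fin (suc m) → Set p} (P? : ∀ k → Dec (P k)) →
  (P Fin.zero → ¬ ∃ (P ∘ Fin.suc)) → 𝟙 (any? P?) ≡ 𝟙 (P? Fin.zero) + 𝟙 (any? (P? ∘ Fin.suc))
𝟙-any?-suc P? exclusive with P? Fin.zero | any? (P? ∘ Fin.suc)
... | yes P0 | yes P+ = ⊥-elim (exclusive P0 P+)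
... | yes _  | no _   = refl
... | no _   | yes _  = refl
... | no _   | no _   = refl

∑-𝟙-≟-≥ : ∀ c n → n ≤ c → ∑[ m < n ] 𝟙 (c ≟ m) ≡ 0
∑-𝟙-≟-≥ c zero    _   = refl
∑-𝟙-≟-≥ c (suc n) n<c with c ≟ n
... | yes refl = ⊥-elim (ℕ.<-irrefl refl n<c)
... | no _     = ∑-𝟙-≟-≥ c n (ℕ.<⇒≤ n<c)

∑-𝟙-≟-< : ∀ c n → c < n → ∑[ m < n ] 𝟙 (c ≟ m) ≡ 1
∑-𝟙-≟-< c (suc n) c<1+n with c ≟ n
... | yes refl = cong suc (∑-𝟙-≟-≥ c n ℕ.≤-refl)
... | no c≢n   = ∑-𝟙-≟-< c n (ℕ.≤∧≢⇒< (ℕ.≤-pred c<1+n) c≢n)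

∑-𝟙-image : ∀ {μ n} (a : Fin μ → Fin n) → Injective _≡_ _≡_ a →
  ∑[ m < n ] 𝟙 (any? λ k → toℕ (a k) ≟ m) ≡ μ
∑-𝟙-image {zero}  {n} a _     = trans (∑-const n 0) (ℕ.*-zeroʳ n)
∑-𝟙-image {suc μ} {n} a a-inj = begin
  ∑[ m < n ] 𝟙 (any? λ k → toℕ (a k) ≟ m)
    ≡⟨ ∑-cong n (λ m _ → 𝟙-any?-suc (λ k → toℕ (a k) ≟ m) (first-is-unique m)) ⟩
  ∑[ m < n ] (𝟙 (toℕ (a Fin.zero) ≟ m) + 𝟙 (any? λ k → toℕ (a (Fin.suc k)) ≟ m))
    ≡⟨ ∑-distrib-+ n _ _ ⟩
  ∑[ m < n ] 𝟙 (toℕ (a Fin.zero) ≟ m) + ∑[ m < n ] 𝟙 (any? λ k → toℕ (a (Fin.suc k)) ≟ m)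
    ≡⟨ cong₂ _+_ (∑-𝟙-≟-< _ n (toℕ<n (a Fin.zero))) (∑-𝟙-image (a ∘ Fin.suc) (suc-injective ∘ a-inj)) ⟩
  suc μ ∎
  where
  open ≡-Reasoning
  first-is-unique : ∀ m → toℕ (a Fin.zero) ≡ m → ¬ ∃ λ k → toℕ (a (Fin.suc k)) ≡ m
  first-is-unique m a₀≡m (k , aₖ≡m) with a-inj (toℕ-injective (trans a₀≡m (sym aₖ≡m)))
  ... | ()

-- The linear form φ and the Lee norm

φ : ℕ → Point → ℤ
φ R (i , j) = i ℤ.* + R ℤ.+ j ℤ.* + suc R

∥_∥ : Point → ℕ
∥ (i , j) ∥ = ∣ i ∣ + ∣ j ∣

φ-homo-− : ∀ R x y → φ R (x -ᵖ y) ≡ φ R x - φ R y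
φ-homo-− R (i , j) (i' , j') = linear i j i' j' (+ R) (+ suc R)
  where
  linear : ∀ i j i' j' r s →
    (i - i') ℤ.* r ℤ.+ (j - j') ℤ.* s ≡ (i ℤ.* r ℤ.+ j ℤ.* s) - (i' ℤ.* r ℤ.+ j' ℤ.* s)
  linear = solve-∀

∥x-y∥≤∥x-c∥+∥y-c∥ : ∀ x y c → ∥ x -ᵖ y ∥ ≤ ∥ x -ᵖ c ∥ + ∥ y -ᵖ c ∥
∥x-y∥≤∥x-c∥+∥y-c∥ (i , j) (i' , j') (ci , cj) = begin
  ∣ i - i' ∣ + ∣ j - j' ∣
    ≤⟨ ℕ.+-mono-≤ (triangle i i' ci) (triangle j j' cj) ⟩
  (∣ i - ci ∣ + ∣ i' - ci ∣) + (∣ j - cj ∣ + ∣ j' - cj ∣)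
    ≡⟨ interchange ∣ i - ci ∣ _ _ _ ⟩
  (∣ i - ci ∣ + ∣ j - cj ∣) + (∣ i' - ci ∣ + ∣ j' - cj ∣) ∎
  where
  open ℕ.≤-Reasoning
  triangle : ∀ a b c → ∣ a - b ∣ ≤ ∣ a - c ∣ + ∣ b - c ∣
  triangle a b c =
    subst (λ d → ∣ d ∣ ≤ ∣ a - c ∣ + ∣ b - c ∣) (cancel a b c) (ℤ.∣i-j∣≤∣i∣+∣j∣ (a - c) (b - c))
    where
    cancel : ∀ a b c → (a - c) - (b - c) ≡ a - b
    cancel = solve-∀

∣φ∣≤∥∥*[1+R] : ∀ R x → ∣ φ R x ∣ ≤ ∥ x ∥ * suc R
∣φ∣≤∥∥*[1+R] R (i , j) = begin
  ∣ i ℤ.* + R ℤ.+ j ℤ.* + suc R ∣    ≤⟨ ℤ.∣i+j∣≤∣i∣+∣j∣ (i ℤ.* + R) (j ℤ.* + suc R) ⟩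
  ∣ i ℤ.* + R ∣ + ∣ j ℤ.* + suc R ∣  ≡⟨ cong₂ _+_ (ℤ.abs-* i (+ R)) (ℤ.abs-* j (+ suc R)) ⟩
  ∣ i ∣ * R + ∣ j ∣ * suc R          ≤⟨ ℕ.+-monoˡ-≤ _ (ℕ.*-monoʳ-≤ ∣ i ∣ (ℕ.n≤1+n R)) ⟩
  ∣ i ∣ * suc R + ∣ j ∣ * suc R      ≡⟨ ℕ.*-distribʳ-+ (suc R) ∣ i ∣ ∣ j ∣ ⟨
  (∣ i ∣ + ∣ j ∣) * suc R            ∎
  where open ℕ.≤-Reasoning

-- The kernel of φ is spanned by (R+1, −R), whose Lee norm 2R+1 is too large.
φ≡0⇒≡0 : ∀ R x → φ R x ≡ 0ℤ → ∥ x ∥ ≤ R + R → x ≡ (0ℤ , 0ℤ)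
φ≡0⇒≡0 R (u , v) φ≡0 ∥u,v∥≤2R = cong₂ _,_ (ℤ.∣i∣≡0⇒i≡0 ∣u∣≡0) (ℤ.∣i∣≡0⇒i≡0 ∣v∣≡0)
  where
  w = u ℤ.+ v
  ∣u∣≡∣w∣*[1+R] : ∣ u ∣ ≡ ∣ w ∣ * suc R
  ∣u∣≡∣w∣*[1+R] = trans (cong ∣_∣ (trans (u≡ u v (+ R)) (cong (w ℤ.* + suc R -_) φ≡0)))
                        (trans (cong ∣_∣ (ℤ.+-identityʳ (w ℤ.* + suc R))) (ℤ.abs-* w (+ suc R)))
    where
    u≡ : ∀ u v r → u ≡ (u ℤ.+ v) ℤ.* (+ 1 ℤ.+ r) - (u ℤ.* r ℤ.+ v ℤ.* (+ 1 ℤ.+ r))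
    u≡ = solve-∀
  ∣v∣≡∣w∣*R : ∣ v ∣ ≡ ∣ w ∣ * R
  ∣v∣≡∣w∣*R = trans (cong ∣_∣ (trans (v≡ u v (+ R)) (cong (_- w ℤ.* + R) φ≡0)))
                    (trans (cong ∣_∣ (ℤ.+-identityˡ (ℤ.- (w ℤ.* + R))))
                           (trans (ℤ.∣-i∣≡∣i∣ (w ℤ.* + R)) (ℤ.abs-* w (+ R))))
    where
    v≡ : ∀ u v r → v ≡ (u ℤ.* r ℤ.+ v ℤ.* (+ 1 ℤ.+ r)) - (u ℤ.+ v) ℤ.* r
    v≡ = solve-∀
  ∣w∣≡0 : ∣ w ∣ ≡ 0
  ∣w∣≡0 = ℕ.n<1⇒n≡0 (ℕ.*-cancelʳ-< (suc R + R) ∣ w ∣ 1 (begin-strict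
    ∣ w ∣ * (suc R + R)          ≡⟨ ℕ.*-distribˡ-+ ∣ w ∣ (suc R) R ⟩
    ∣ w ∣ * suc R + ∣ w ∣ * R    ≡⟨ cong₂ _+_ ∣u∣≡∣w∣*[1+R] ∣v∣≡∣w∣*R ⟨
    ∣ u ∣ + ∣ v ∣                ≤⟨ ∥u,v∥≤2R ⟩
    R + R                        <⟨ ℕ.n<1+n (R + R) ⟩
    suc R + R                    ≡⟨ ℕ.*-identityˡ (suc R + R) ⟨
    1 * (suc R + R)              ∎))
    where open ℕ.≤-Reasoning
  ∣u∣≡0 : ∣ u ∣ ≡ 0
  ∣u∣≡0 = trans ∣u∣≡∣w∣*[1+R] (cong (_* suc R) ∣w∣≡0)
  ∣v∣≡0 : ∣ v ∣ ≡ 0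
  ∣v∣≡0 = trans ∣v∣≡∣w∣*R (cong (_* R) ∣w∣≡0)

φ-parallelogram : ∀ R x y x' y' → x -ᵖ y ≡ x' -ᵖ y' → φ R x ℤ.+ φ R y' ≡ φ R x' ℤ.+ φ R y
φ-parallelogram R x y x' y' x-y≡x'-y' = begin
  φ R x ℤ.+ φ R y'                      ≡⟨ regroup (φ R x) (φ R y) (φ R y') ⟩
  (φ R x - φ R y) ℤ.+ (φ R y ℤ.+ φ R y')  ≡⟨ cong (ℤ._+ (φ R y ℤ.+ φ R y')) φx-φy≡φx'-φy' ⟩
  (φ R x' - φ R y') ℤ.+ (φ R y ℤ.+ φ R y') ≡⟨ cancel (φ R x') (φ R y') (φ R y) ⟩
  φ R x' ℤ.+ φ R y                      ∎
  where
  open ≡-Reasoning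
  φx-φy≡φx'-φy' : φ R x - φ R y ≡ φ R x' - φ R y'
  φx-φy≡φx'-φy' = trans (sym (φ-homo-− R x y)) (trans (cong (φ R) x-y≡x'-y') (φ-homo-− R x' y'))
  regroup : ∀ a b d → a ℤ.+ d ≡ (a - b) ℤ.+ (b ℤ.+ d)
  regroup = solve-∀
  cancel : ∀ c d b → (c - d) ℤ.+ (b ℤ.+ d) ≡ c ℤ.+ b
  cancel = solve-∀

φ-injective-on-LeeSphere : ∀ {n R} .{{_ : NonZero n}} → 2 * R * R + 2 * R + 1 ≤ n → ∀ c x y →
  InLeeSphere R c x → InLeeSphere R c y → φ R x ≡ φ R y [mod n ] → x ≡ y
φ-injective-on-LeeSphere {n} {R} hn c@(ci , cj) x@(xi , xj) y@(yi , yj) x∈ y∈ φx≡φy =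
  cong₂ _,_ (ℤ.i-j≡0⇒i≡j xi yi (cong proj₁ x-y≡0)) (ℤ.i-j≡0⇒i≡j xj yj (cong proj₂ x-y≡0))
  where
  ∥x-y∥≤2R : ∥ x -ᵖ y ∥ ≤ R + R
  ∥x-y∥≤2R = ℕ.≤-trans (∥x-y∥≤∥x-c∥+∥y-c∥ x y c) (ℕ.+-mono-≤ x∈ y∈)
  ∣φx-φy∣<n : ∣ φ R x - φ R y ∣ < n
  ∣φx-φy∣<n = begin-strict
    ∣ φ R x - φ R y ∣     ≡⟨ cong ∣_∣ (φ-homo-− R x y) ⟨
    ∣ φ R (x -ᵖ y) ∣      ≤⟨ ∣φ∣≤∥∥*[1+R] R (x -ᵖ y) ⟩
    ∥ x -ᵖ y ∥ * suc R    ≤⟨ ℕ.*-monoˡ-≤ (suc R) ∥x-y∥≤2R ⟩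
    (R + R) * suc R       <⟨ ℕ.n<1+n _ ⟩
    suc ((R + R) * suc R) ≡⟨ bound R ⟩
    2 * R * R + 2 * R + 1 ≤⟨ hn ⟩
    n                     ∎
    where
    open ℕ.≤-Reasoning
    bound : ∀ R → suc ((R + R) * suc R) ≡ 2 * R * R + 2 * R + 1
    bound = ℕ-solve-∀
  x-y≡0 : x -ᵖ y ≡ (0ℤ , 0ℤ)
  x-y≡0 = φ≡0⇒≡0 R (x -ᵖ y)
    (trans (φ-homo-− R x y) (ℤ.i≡j⇒i-j≡0 (≡-mod∧∣-∣<⇒≡ φx≡φy ∣φx-φy∣<n))) ∥x-y∥≤2R

module _ {n μ} .{{_ : NonZero n}} {a : Fin μ → Fin n} (b₂ : IsB₂Sequence n μ a) where

  private
    sum-comm : ∀ k l → (toℕ (a k) + toℕ (a l)) % n ≡ (toℕ (a l) + toℕ (a k)) % n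
    sum-comm k l = cong (_% n) (ℕ.+-comm (toℕ (a k)) (toℕ (a l)))

  B₂-unordered : ∀ k₁ k₂ k₃ k₄ → (toℕ (a k₁) + toℕ (a k₂)) % n ≡ (toℕ (a k₃) + toℕ (a k₄)) % n →
    (k₁ ≡ k₃ × k₂ ≡ k₄) ⊎ (k₁ ≡ k₄ × k₂ ≡ k₃)
  B₂-unordered k₁ k₂ k₃ k₄ eq with ℕ.≤-total (toℕ k₁) (toℕ k₂) | ℕ.≤-total (toℕ k₃) (toℕ k₄)
  ... | inj₁ p | inj₁ q = inj₁ (proj₂ b₂ k₁ k₂ k₃ k₄ p q eq)
  ... | inj₁ p | inj₂ q = inj₂ (proj₂ b₂ k₁ k₂ k₄ k₃ p q (trans eq (sum-comm k₃ k₄)))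
  ... | inj₂ p | inj₁ q = inj₂ (Product.swap (proj₂ b₂ k₂ k₁ k₃ k₄ p q (trans (sum-comm k₂ k₁) eq)))
  ... | inj₂ p | inj₂ q =
    inj₁ (Product.swap (proj₂ b₂ k₂ k₁ k₄ k₃ p q (trans (sum-comm k₂ k₁) (trans eq (sum-comm k₃ k₄)))))

module _ {n μ} .{{_ : NonZero n}} (a : Fin μ → Fin n) where

  𝟙∈D : ℕ → ℕ
  𝟙∈D m = 𝟙 (any? λ k → toℕ (a k) ≟ m)

  𝟙D : ℤ → ℕ
  𝟙D x = 𝟙∈D (x %ℕ n)

  𝟙D-+-multiple : ∀ {x} y k → x ≡ y ℤ.+ k ℤ.* + n → 𝟙D x ≡ 𝟙D y
  𝟙D-+-multiple y k x≡y+kn =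
    cong 𝟙∈D (≡-mod⇒%ℕ-≡ (+-multiple⇒≡-mod y k x≡y+kn))

  ∑-𝟙D-window : Injective _≡_ _≡_ a → ∀ s → ∑[ j < n ] 𝟙D (s ℤ.+ + j) ≡ μ
  ∑-𝟙D-window a-inj s = begin
    ∑[ j < n ] 𝟙D (s ℤ.+ + j) ≡⟨ ∑-periodic 𝟙D 𝟙D-periodic s ⟩
    ∑[ j < n ] 𝟙D (+ j)       ≡⟨ ∑-cong n (λ j j<n → cong 𝟙∈D (m<n⇒m%n≡m j<n)) ⟩
    ∑[ m < n ] 𝟙∈D m          ≡⟨ ∑-𝟙-image a a-inj ⟩
    μ                         ∎
    where
    open ≡-Reasoning
    𝟙D-periodic : ∀ x → 𝟙D (x ℤ.+ + n) ≡ 𝟙D x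
    𝟙D-periodic x = 𝟙D-+-multiple x (+ 1) (once x (+ n))
      where
      once : ∀ x n → x ℤ.+ n ≡ x ℤ.+ + 1 ℤ.* n
      once = solve-∀

  -- The substitution i ↦ i − J, allowed since the summand is n-periodic in i.
  ∑-𝟙D-shear : ∀ R i₀ J →
    ∑[ i < n ] 𝟙D ((i₀ ℤ.+ + i) ℤ.* + R ℤ.+ J ℤ.* + suc R) ≡ ∑[ i < n ] 𝟙D ((i₀ ℤ.+ + i) ℤ.* + R ℤ.+ J)
  ∑-𝟙D-shear R i₀ J = begin
    ∑[ i < n ] G (i₀ ℤ.+ + i)       ≡⟨ ∑-periodic G G-periodic i₀ ⟩
    ∑[ i < n ] G (+ i)              ≡⟨ ∑-periodic G G-periodic (i₀ - J) ⟨
    ∑[ i < n ] G ((i₀ - J) ℤ.+ + i) ≡⟨ ∑-cong n (λ i _ → cong 𝟙D (shear i₀ J (+ i) (+ R))) ⟩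
    ∑[ i < n ] 𝟙D ((i₀ ℤ.+ + i) ℤ.* + R ℤ.+ J) ∎
    where
    open ≡-Reasoning
    G : ℤ → ℕ
    G x = 𝟙D (x ℤ.* + R ℤ.+ J ℤ.* + suc R)
    G-periodic : ∀ x → G (x ℤ.+ + n) ≡ G x
    G-periodic x = 𝟙D-+-multiple (x ℤ.* + R ℤ.+ J ℤ.* + suc R) (+ R) (shift x J (+ n) (+ R))
      where
      shift : ∀ x J n r → (x ℤ.+ n) ℤ.* r ℤ.+ J ℤ.* (+ 1 ℤ.+ r) ≡ (x ℤ.* r ℤ.+ J ℤ.* (+ 1 ℤ.+ r)) ℤ.+ r ℤ.* n
      shift = solve-∀
    shear : ∀ i₀ J i r → ((i₀ - J) ℤ.+ i) ℤ.* r ℤ.+ J ℤ.* (+ 1 ℤ.+ r) ≡ (i₀ ℤ.+ i) ℤ.* r ℤ.+ J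
    shear = solve-∀

  ∑∑-𝟙D-φ : Injective _≡_ _≡_ a → ∀ R i₀ j₀ →
    ∑[ i < n ] ∑[ j < n ] 𝟙D (φ R (i₀ ℤ.+ + i , j₀ ℤ.+ + j)) ≡ n * μ
  ∑∑-𝟙D-φ a-inj R i₀ j₀ = begin
    ∑[ i < n ] ∑[ j < n ] 𝟙D ((i₀ ℤ.+ + i) ℤ.* + R ℤ.+ (j₀ ℤ.+ + j) ℤ.* + suc R)
      ≡⟨ ∑-comm n n _ ⟩
    ∑[ j < n ] ∑[ i < n ] 𝟙D ((i₀ ℤ.+ + i) ℤ.* + R ℤ.+ (j₀ ℤ.+ + j) ℤ.* + suc R)
      ≡⟨ ∑-cong n (λ j _ → ∑-𝟙D-shear R i₀ (j₀ ℤ.+ + j)) ⟩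
    ∑[ j < n ] ∑[ i < n ] 𝟙D ((i₀ ℤ.+ + i) ℤ.* + R ℤ.+ (j₀ ℤ.+ + j))
      ≡⟨ ∑-comm n n _ ⟨
    ∑[ i < n ] ∑[ j < n ] 𝟙D ((i₀ ℤ.+ + i) ℤ.* + R ℤ.+ (j₀ ℤ.+ + j))
      ≡⟨ ∑-cong n (λ i _ → ∑-cong n (λ j _ → cong 𝟙D (sym (ℤ.+-assoc ((i₀ ℤ.+ + i) ℤ.* + R) j₀ (+ j))))) ⟩
    ∑[ i < n ] ∑[ j < n ] 𝟙D (((i₀ ℤ.+ + i) ℤ.* + R ℤ.+ j₀) ℤ.+ + j)
      ≡⟨ ∑-cong n (λ i _ → ∑-𝟙D-window a-inj ((i₀ ℤ.+ + i) ℤ.* + R ℤ.+ j₀)) ⟩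
    ∑[ i < n ] μ
      ≡⟨ ∑-const n μ ⟩
    n * μ ∎
    where open ≡-Reasoning

  arrayA-density : Injective _≡_ _≡_ a → ∀ R → HasDensity (arrayA n μ a R) (arrayA? n μ a R) n n μ n
  arrayA-density a-inj R i₀ j₀ = begin
    windowCount (arrayA n μ a R) (arrayA? n μ a R) i₀ j₀ n n * n
      ≡⟨ cong (_* n) (windowCount≡∑∑ _ _ i₀ j₀ n n) ⟩
    (∑[ i < n ] ∑[ j < n ] 𝟙D (φ R (i₀ ℤ.+ + i , j₀ ℤ.+ + j))) * n
      ≡⟨ cong (_* n) (∑∑-𝟙D-φ a-inj R i₀ j₀) ⟩
    n * μ * n
      ≡⟨ rearrange n μ ⟩
    μ * (n * n) ∎
    where
    open ≡-Reasoning
    rearrange : ∀ n μ → n * μ * n ≡ μ * (n * n)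
    rearrange = ℕ-solve-∀

  arrayA-periodic : ∀ R → DoublyPeriodic (arrayA n μ a R) n n
  arrayA-periodic R i j = same-residue (i ℤ.+ + n) j (+ R) (next-column i j (+ n) (+ R))
                        , same-residue i (j ℤ.+ + n) (+ suc R) (next-row i j (+ n) (+ R))
    where
    same-residue : ∀ i' j' k → φ R (i' , j') ≡ φ R (i , j) ℤ.+ k ℤ.* + n →
      arrayA n μ a R i j ⇔ arrayA n μ a R i' j'
    same-residue i' j' k φ'≡φ+kn = mk⇔ (λ (l , e) → l , trans e f≡f') (λ (l , e) → l , trans e (sym f≡f'))
      where
      f≡f' = sym (≡-mod⇒%ℕ-≡ (+-multiple⇒≡-mod (φ R (i , j)) k φ'≡φ+kn))
    next-column : ∀ i j n r →
      (i ℤ.+ n) ℤ.* r ℤ.+ j ℤ.* (+ 1 ℤ.+ r) ≡ (i ℤ.* r ℤ.+ j ℤ.* (+ 1 ℤ.+ r)) ℤ.+ r ℤ.* n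
    next-column = solve-∀
    next-row : ∀ i j n r →
      i ℤ.* r ℤ.+ (j ℤ.+ n) ℤ.* (+ 1 ℤ.+ r) ≡ (i ℤ.* r ℤ.+ j ℤ.* (+ 1 ℤ.+ r)) ℤ.+ (+ 1 ℤ.+ r) ℤ.* n
    next-row = solve-∀

  LeeSphereDots : ℕ → Point → Point → Set
  LeeSphereDots R c x = InLeeSphere R c x × arrayA n μ a R (proj₁ x) (proj₂ x)

  private
    same-label⇒same-dot : ∀ {R} → 2 * R * R + 2 * R + 1 ≤ n → ∀ c p q {k l} →
      InLeeSphere R c p → InLeeSphere R c q → toℕ (a k) ≡ φ R p %ℕ n → toℕ (a l) ≡ φ R q %ℕ n →
      k ≡ l → p ≡ q
    same-label⇒same-dot hn c p q p∈ q∈ ek el refl =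
      φ-injective-on-LeeSphere hn c p q p∈ q∈ (%ℕ-≡⇒≡-mod (trans (sym ek) el))

  LeeSphereDots-DDC : ∀ R → 2 * R * R + 2 * R + 1 ≤ n → IsB₂Sequence n μ a → ∀ c → IsDDC (LeeSphereDots R c)
  LeeSphereDots-DDC R hn b₂ c x y x' y' (x∈ , kx , ex) (y∈ , ky , ey) (x'∈ , kx' , ex') (y'∈ , ky' , ey')
                    x≢y _ x-y≡x'-y'
    with B₂-unordered b₂ kx ky' kx' ky
           (residues-+-cong (φ R x) (φ R y') (φ R x') (φ R y) ex ey' ex' ey
                            (φ-parallelogram R x y x' y' x-y≡x'-y'))
  ... | inj₁ (kx≡kx' , ky'≡ky) = same-label⇒same-dot hn c x x' x∈ x'∈ ex ex' kx≡kx'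
                               , same-label⇒same-dot hn c y y' y∈ y'∈ ey ey' (sym ky'≡ky)
  ... | inj₂ (kx≡ky , _) = ⊥-elim (x≢y (same-label⇒same-dot hn c x y x∈ y∈ ex ey kx≡ky))

theorem17 : (r : ℕ) → 1 ≤ r → (n : ℕ) .{{_ : NonZero n}} →
    2 * (r / 2) * (r / 2) + 2 * (r / 2) + 1 ≤ n →
    (μ : ℕ) → (a : Fin μ → Fin n) → IsB₂Sequence n μ a →
    DoublyPeriodic (arrayA n μ a (r / 2)) n n ×
    HasDensity (arrayA n μ a (r / 2)) (arrayA? n μ a (r / 2)) n n μ n ×
    (∀ c → IsDDC (λ x → InLeeSphere (r / 2) c x × arrayA n μ a (r / 2) (proj₁ x) (proj₂ x)))
theorem17 r _ n hn μ a b₂ =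
    arrayA-periodic a (r / 2)
  , arrayA-density a (λ {k} {l} → proj₁ b₂ k l) (r / 2)
  , LeeSphereDots-DDC a (r / 2) hn b₂
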